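{- Let $k\ge 1$ and let $\tau$ be a non-empty generalized pattern with no hyphens. Let $A_\tau(x;k)$ be the generating function for the number of words in $[k]^n$ avoiding $\tau$, and let $A^*_\tau(x;k)=\sum_{n\ge 0} a^*_\tau(n;k)x^n$, where $a^*_\tau(n;k)$ is the number of words in $[k]^n$ that quasi-avoid $\tau$. Then $$A^*_\tau(x;k)=(kx-1)A_\tau(x;k)+1.$$
   Context: For a positive integer $k$, $[k]=\{1,\dots,k\}$ and $[k]^n$ is the set of words of length $n$ over $[k]$. A generalized pattern with no hyphens is a word $\tau=\tau_1\cdots\tau_m$ over $[\ell]$ containing every letter of $[\ell]$ at least once. A word $\sigma=\sigma_1\cdots\sigma_n$ contains $\tau$ if there is an index $i$ such that $\sigma_{i}\sigma_{i+1}\cdots\sigma_{i+m-1}$ is order-isomorphic to $\tau$ (i.e. $\sigma_{i+a-1}<\sigma_{i+b-1}$ iff $\tau_a<\tau_b$ and $\sigma_{i+a-1}=\sigma_{i+b-1}$ iff $\tau_a=\tau_b$); such a factor is an occurrence of $\tau$. Otherwise $\sigma$ avoids $\tau$. $A_\tau(x;k)=\sum_{n\ge0}a_\tau(n;k)x^n$ where $a_\tau(n;k)$ is the number of words in $[k]^n$ avoiding $\tau$ (the empty word counts, so $a_\tau(0;k)=1$). A word $\sigma$ quasi-avoids $\tau$ if $\sigma$ has exactly one occurrence of $\tau$ and this occurrence consists of the $m$ rightmost letters of $\sigma$. -}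

module Defs where

open import Data.Bool using (Bool; true; false; _∧_; _∨_; not)
open import Data.Nat using (ℕ; zero; suc; _+_; _∸_; _<ᵇ_; _≡ᵇ_; _≤ᵇ_)
open import Data.Integer as ℤ using (ℤ)
open import Data.Product using (_×_; _,_)
open import Data.List using (List; []; _∷_; length; take; drop; zip; upTo; filterᵇ; map; concatMap)

-- Letters are natural numbers; [k] = {1,…,k}.

words : ℕ → ℕ → List (List ℕ)
words k zero    = [] ∷ []
words k (suc n) = concatMap (λ c → map (c ∷_) (words k n)) (map suc (upTo k))

allᵇ : {X : Set} → (X → Bool) → List X → Bool
allᵇ p []       = true
allᵇ p (x ∷ xs) = p x ∧ allᵇ p xs

_⇔ᵇ_ : Bool → Bool → Bool
a ⇔ᵇ b = (a ∧ b) ∨ (not a ∧ not b)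

orderIsoᵇ : List ℕ → List ℕ → Bool
orderIsoᵇ u v =
  (length u ≡ᵇ length v) ∧
  allᵇ (λ { (x , p) → allᵇ (λ { (y , q) →
         ((x <ᵇ y) ⇔ᵇ (p <ᵇ q)) ∧ ((x ≡ᵇ y) ⇔ᵇ (p ≡ᵇ q)) }) (zip u v) }) (zip u v)

occAtᵇ : List ℕ → List ℕ → ℕ → Bool
occAtᵇ τ σ i = (i + length τ ≤ᵇ length σ) ∧ orderIsoᵇ (take (length τ) (drop i σ)) τ

occurrences : List ℕ → List ℕ → List ℕ
occurrences τ σ = filterᵇ (occAtᵇ τ σ) (upTo (length σ))

avoidsᵇ : List ℕ → List ℕ → Bool
avoidsᵇ τ σ = length (occurrences τ σ) ≡ᵇ 0

quasiAvoidsᵇ : List ℕ → List ℕ → Bool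
quasiAvoidsᵇ τ σ = (length (occurrences τ σ) ≡ᵇ 1) ∧ occAtᵇ τ σ (length σ ∸ length τ)

a : List ℕ → ℕ → ℕ → ℕ
a τ k n = length (filterᵇ (avoidsᵇ τ) (words k n))

a* : List ℕ → ℕ → ℕ → ℕ
a* τ k n = length (filterᵇ (quasiAvoidsᵇ τ) (words k n))

Series : Set
Series = ℕ → ℤ

_⊕_ : Series → Series → Series
(f ⊕ g) n = f n ℤ.+ g n

_⊖_ : Series → Series → Series
(f ⊖ g) n = f n ℤ.- g n

_⊛_ : ℤ → Series → Series
(c ⊛ f) n = c ℤ.* f n

X· : Series → Series
X· f zero    = ℤ.0ℤ
X· f (suc n) = f n

one : Series
one zero    = ℤ.1ℤ
one (suc n) = ℤ.0ℤ

A : List ℕ → ℕ → Series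
A τ k n = ℤ.+ (a τ k n)

A* : List ℕ → ℕ → Series
A* τ k n = ℤ.+ (a* τ k n)

data _∈ℕ_ (x : ℕ) : List ℕ → Set where
  here  : ∀ {xs} → x ∈ℕ (x ∷ xs)
  there : ∀ {y xs} → x ∈ℕ xs → x ∈ℕ (y ∷ xs)

-- A word of length n + 1 is w c with |w| = n, and the occurrences of τ in w c are those in w
-- together with possibly one new occurrence, formed by the last |τ| letters. Hence w c avoids
-- or quasi-avoids τ exactly when w avoids τ, and never both; summing over w and c gives
-- a(n+1) + a*(n+1) = k a(n), the coefficient of x^(n+1) in the claim. At x^0 both sides vanish.

module Submission where

open import Defs
open import Data.Nat using (ℕ; zero; suc; _+_; _*_; _∸_; _≡ᵇ_; _≤_; _<_; _≤?_; _≟_; s≤s; z<s)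
open import Data.Nat.Properties
  using (≤-refl; ≤-reflexive; ≤-pred; ≤-trans; <⇒≢; <⇒≱; ≤∧≢⇒<; ≰⇒>; m≤n⇒m≤1+n; m<m+n; m≤m+n;
         m≤n+m∸n; m∸n≤m; m+n∸n≡m; m+n∸m≡n; +-comm; +-assoc; +-identityʳ; *-zeroʳ; *-distribˡ-+;
         +-commutativeSemigroup)
open import Data.Integer as ℤ using (ℤ)
open import Algebra.Properties.CommutativeSemigroup +-commutativeSemigroup using (interchange)
import Data.Integer.Properties as ℤₚ
open import Data.Bool using (Bool; true; false; _∧_)
open import Data.List using (List; []; _∷_; _++_; _∷ʳ_; length; take; drop; map; upTo; filterᵇ; concatMap)
open import Data.List.Properties using (length-map; length-upTo; length-++; length-++-≤ˡ; upTo-∷ʳ)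
open import Data.Product using (_×_)
open import Data.Empty using (⊥-elim)
open import Function using (_∘_)
open import Relation.Binary.PropositionalEquality
  using (_≡_; refl; sym; trans; cong; cong₂; subst; module ≡-Reasoning)
open import Relation.Nullary using (¬_; yes; no)
open import Relation.Nullary.Decidable using (dec-true; dec-false)

private variable X Y : Set

ind : Bool → ℕ
ind true  = 1
ind false = 0

∑ : List X → (X → ℕ) → ℕ
∑ []       f = 0
∑ (x ∷ xs) f = f x + ∑ xs f

length-filterᵇ : (p : X → Bool) (xs : List X) → length (filterᵇ p xs) ≡ ∑ xs (λ x → ind (p x))
length-filterᵇ p []       = refl
length-filterᵇ p (x ∷ xs) with p x
... | true  = cong suc (length-filterᵇ p xs)
... | false = length-filterᵇ p xs

∑-cong : (xs : List X) {f g : X → ℕ} → (∀ x → f x ≡ g x) → ∑ xs f ≡ ∑ xs g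
∑-cong []       f≗g = refl
∑-cong (x ∷ xs) f≗g = cong₂ _+_ (f≗g x) (∑-cong xs f≗g)

∑-++ : (xs ys : List X) (f : X → ℕ) → ∑ (xs ++ ys) f ≡ ∑ xs f + ∑ ys f
∑-++ []       ys f = refl
∑-++ (x ∷ xs) ys f = trans (cong (f x +_) (∑-++ xs ys f)) (sym (+-assoc (f x) _ _))

∑-map : (h : X → Y) (xs : List X) (f : Y → ℕ) → ∑ (map h xs) f ≡ ∑ xs (λ x → f (h x))
∑-map h []       f = refl
∑-map h (x ∷ xs) f = cong (f (h x) +_) (∑-map h xs f)

∑-concatMap : (h : X → List Y) (xs : List X) (f : Y → ℕ) →
              ∑ (concatMap h xs) f ≡ ∑ xs (λ x → ∑ (h x) f)
∑-concatMap h []       f = refl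
∑-concatMap h (x ∷ xs) f =
  trans (∑-++ (h x) (concatMap h xs) f) (cong (∑ (h x) f +_) (∑-concatMap h xs f))

∑-distrib-+ : (xs : List X) (f g : X → ℕ) → ∑ xs (λ x → f x + g x) ≡ ∑ xs f + ∑ xs g
∑-distrib-+ []       f g = refl
∑-distrib-+ (x ∷ xs) f g =
  trans (cong (f x + g x +_) (∑-distrib-+ xs f g)) (interchange (f x) (g x) (∑ xs f) (∑ xs g))

∑-const : (xs : List X) (c : ℕ) → ∑ xs (λ _ → c) ≡ length xs * c
∑-const []       c = refl
∑-const (x ∷ xs) c = cong (c +_) (∑-const xs c)

∑-*ˡ : (xs : List X) (c : ℕ) (f : X → ℕ) → ∑ xs (λ x → c * f x) ≡ c * ∑ xs f
∑-*ˡ []       c f = sym (*-zeroʳ c)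
∑-*ˡ (x ∷ xs) c f = trans (cong (c * f x +_) (∑-*ˡ xs c f)) (sym (*-distribˡ-+ c (f x) _))

∑-upTo-suc : (n : ℕ) (f : ℕ → ℕ) → ∑ (upTo (suc n)) f ≡ ∑ (upTo n) f + f n
∑-upTo-suc n f = begin
  ∑ (upTo (suc n)) f          ≡⟨ cong (λ is → ∑ is f) (sym (upTo-∷ʳ n)) ⟩
  ∑ (upTo n ∷ʳ n) f           ≡⟨ ∑-++ (upTo n) (n ∷ []) f ⟩
  ∑ (upTo n) f + (f n + 0)    ≡⟨ cong (∑ (upTo n) f +_) (+-identityʳ (f n)) ⟩
  ∑ (upTo n) f + f n          ∎
  where open ≡-Reasoning

∑-upTo-cong : (n : ℕ) {f g : ℕ → ℕ} → (∀ i → i < n → f i ≡ g i) → ∑ (upTo n) f ≡ ∑ (upTo n) g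
∑-upTo-cong zero    f≗g = refl
∑-upTo-cong (suc n) {f} {g} f≗g = begin
  ∑ (upTo (suc n)) f  ≡⟨ ∑-upTo-suc n f ⟩
  ∑ (upTo n) f + f n  ≡⟨ cong₂ _+_ (∑-upTo-cong n (λ i i<n → f≗g i (m≤n⇒m≤1+n i<n))) (f≗g n ≤-refl) ⟩
  ∑ (upTo n) g + g n  ≡⟨ sym (∑-upTo-suc n g) ⟩
  ∑ (upTo (suc n)) g  ∎
  where open ≡-Reasoning

∑-upTo-except : (n j : ℕ) {f g : ℕ → ℕ} → j < n → g j ≡ 0 →
                (∀ i → i < n → ¬ i ≡ j → f i ≡ g i) → ∑ (upTo n) f ≡ f j + ∑ (upTo n) g
∑-upTo-except (suc n) j {f} {g} j<1+n gj≡0 f≗g with j ≟ n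
... | yes refl = begin
  ∑ (upTo (suc j)) f        ≡⟨ ∑-upTo-suc j f ⟩
  ∑ (upTo j) f + f j        ≡⟨ +-comm (∑ (upTo j) f) (f j) ⟩
  f j + ∑ (upTo j) f        ≡⟨ cong (f j +_) (∑-upTo-cong j (λ i i<j → f≗g i (m≤n⇒m≤1+n i<j) (<⇒≢ i<j))) ⟩
  f j + ∑ (upTo j) g        ≡⟨ cong (f j +_) (sym (trans (cong (∑ (upTo j) g +_) gj≡0) (+-identityʳ _))) ⟩
  f j + (∑ (upTo j) g + g j) ≡⟨ cong (f j +_) (sym (∑-upTo-suc j g)) ⟩
  f j + ∑ (upTo (suc j)) g  ∎
  where open ≡-Reasoning
... | no j≢n = begin
  ∑ (upTo (suc n)) f          ≡⟨ ∑-upTo-suc n f ⟩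
  ∑ (upTo n) f + f n          ≡⟨ cong₂ _+_ (∑-upTo-except n j j<n gj≡0 (λ i i<n → f≗g i (m≤n⇒m≤1+n i<n)))
                                            (f≗g n ≤-refl (j≢n ∘ sym)) ⟩
  (f j + ∑ (upTo n) g) + g n  ≡⟨ +-assoc (f j) _ _ ⟩
  f j + (∑ (upTo n) g + g n)  ≡⟨ cong (f j +_) (sym (∑-upTo-suc n g)) ⟩
  f j + ∑ (upTo (suc n)) g    ∎
  where
  open ≡-Reasoning
  j<n : j < n
  j<n = ≤∧≢⇒< (≤-pred j<1+n) j≢n

letters : ℕ → List ℕ
letters k = map suc (upTo k)

length-letters : (k : ℕ) → length (letters k) ≡ k
length-letters k = trans (length-map suc (upTo k)) (length-upTo k)

∑-words-suc : (k n : ℕ) (f : List ℕ → ℕ) →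
              ∑ (words k (suc n)) f ≡ ∑ (letters k) (λ c → ∑ (words k n) (λ w → f (c ∷ w)))
∑-words-suc k n f = trans (∑-concatMap (λ c → map (c ∷_) (words k n)) (letters k) f)
                          (∑-cong (letters k) (λ c → ∑-map (c ∷_) (words k n) f))

∑-words-∷ʳ : (k n : ℕ) (f : List ℕ → ℕ) →
             ∑ (words k (suc n)) f ≡ ∑ (words k n) (λ w → ∑ (letters k) (λ c → f (w ∷ʳ c)))
∑-words-∷ʳ k zero f =
  trans (∑-words-suc k zero f) (trans (∑-cong (letters k) (λ c → +-identityʳ _)) (sym (+-identityʳ _)))
∑-words-∷ʳ k (suc n) f = begin
  ∑ (words k (suc (suc n))) f
    ≡⟨ ∑-words-suc k (suc n) f ⟩
  ∑ (letters k) (λ c → ∑ (words k (suc n)) (λ v → f (c ∷ v)))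
    ≡⟨ ∑-cong (letters k) (λ c → ∑-words-∷ʳ k n (λ v → f (c ∷ v))) ⟩
  ∑ (letters k) (λ c → ∑ (words k n) (λ w → ∑ (letters k) (λ d → f (c ∷ w ∷ʳ d))))
    ≡⟨ sym (∑-words-suc k n (λ v → ∑ (letters k) (λ d → f (v ∷ʳ d)))) ⟩
  ∑ (words k (suc n)) (λ v → ∑ (letters k) (λ d → f (v ∷ʳ d)))
    ∎
  where open ≡-Reasoning

count-words-∷ʳ : (k n : ℕ) (P Q R : List ℕ → Bool) →
                 (∀ w c → ind (P (w ∷ʳ c)) + ind (Q (w ∷ʳ c)) ≡ ind (R w)) →
                 length (filterᵇ P (words k (suc n))) + length (filterᵇ Q (words k (suc n)))
                   ≡ k * length (filterᵇ R (words k n))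
count-words-∷ʳ k n P Q R split = begin
  length (filterᵇ P (words k (suc n))) + length (filterᵇ Q (words k (suc n)))
    ≡⟨ cong₂ _+_ (length-filterᵇ P (words k (suc n))) (length-filterᵇ Q (words k (suc n))) ⟩
  ∑ (words k (suc n)) (ind ∘ P) + ∑ (words k (suc n)) (ind ∘ Q)
    ≡⟨ sym (∑-distrib-+ (words k (suc n)) (ind ∘ P) (ind ∘ Q)) ⟩
  ∑ (words k (suc n)) (λ v → ind (P v) + ind (Q v))
    ≡⟨ ∑-words-∷ʳ k n _ ⟩
  ∑ (words k n) (λ w → ∑ (letters k) (λ c → ind (P (w ∷ʳ c)) + ind (Q (w ∷ʳ c))))
    ≡⟨ ∑-cong (words k n) (λ w → ∑-cong (letters k) (split w)) ⟩
  ∑ (words k n) (λ w → ∑ (letters k) (λ _ → ind (R w)))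
    ≡⟨ ∑-cong (words k n) (λ w → trans (∑-const (letters k) _) (cong (_* ind (R w)) (length-letters k))) ⟩
  ∑ (words k n) (λ w → k * ind (R w))
    ≡⟨ ∑-*ˡ (words k n) k (ind ∘ R) ⟩
  k * ∑ (words k n) (ind ∘ R)
    ≡⟨ cong (k *_) (sym (length-filterᵇ R (words k n))) ⟩
  k * length (filterᵇ R (words k n))
    ∎
  where open ≡-Reasoning

take-++ˡ : (m : ℕ) (xs ys : List X) → m ≤ length xs → take m (xs ++ ys) ≡ take m xs
take-++ˡ zero    xs       ys m≤|xs|       = refl
take-++ˡ (suc m) (x ∷ xs) ys (s≤s m≤|xs|) = cong (x ∷_) (take-++ˡ m xs ys m≤|xs|)

take-drop-++ˡ : (i m : ℕ) (xs ys : List X) → i + m ≤ length xs →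
                take m (drop i (xs ++ ys)) ≡ take m (drop i xs)
take-drop-++ˡ zero    m xs       ys i+m≤|xs|       = take-++ˡ m xs ys i+m≤|xs|
take-drop-++ˡ (suc i) m (x ∷ xs) ys (s≤s i+m≤|xs|) = take-drop-++ˡ i m xs ys i+m≤|xs|

occAt-++ : (τ w v : List ℕ) (i : ℕ) → i + length τ ≤ length w → occAtᵇ τ (w ++ v) i ≡ occAtᵇ τ w i
occAt-++ τ w v i i+m≤|w| = cong₂ _∧_
  (trans (dec-true (i + length τ ≤? length (w ++ v)) (≤-trans i+m≤|w| (length-++-≤ˡ w)))
         (sym (dec-true (i + length τ ≤? length w) i+m≤|w|)))
  (cong (λ u → orderIsoᵇ u τ) (take-drop-++ˡ i (length τ) w v i+m≤|w|))

occAt-beyond : (τ σ : List ℕ) (i : ℕ) → length σ < i + length τ → occAtᵇ τ σ i ≡ false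
occAt-beyond τ σ i |σ|<i+m = cong (_∧ orderIsoᵇ (take (length τ) (drop i σ)) τ)
                                  (dec-false (i + length τ ≤? length σ) (<⇒≱ |σ|<i+m))

length-occurrences-∷ʳ : (t : ℕ) (ts w : List ℕ) (c : ℕ) →
  let τ = t ∷ ts ; σ = w ∷ʳ c in
  length (occurrences τ σ) ≡ ind (occAtᵇ τ σ (length σ ∸ length τ)) + length (occurrences τ w)
length-occurrences-∷ʳ t ts w c = begin
  length (occurrences τ σ)                        ≡⟨ length-filterᵇ p (upTo (length σ)) ⟩
  ∑ (upTo (length σ)) (ind ∘ p)                   ≡⟨ ∑-upTo-except (length σ) j j<|σ| (cong ind qj≡false) p≗q ⟩
  ind (p j) + ∑ (upTo (length σ)) (ind ∘ q)       ≡⟨ cong (λ n → ind (p j) + ∑ (upTo n) (ind ∘ q)) |σ|≡1+N ⟩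
  ind (p j) + ∑ (upTo (suc N)) (ind ∘ q)          ≡⟨ cong (ind (p j) +_) (∑-upTo-suc N (ind ∘ q)) ⟩
  ind (p j) + (∑ (upTo N) (ind ∘ q) + ind (q N))  ≡⟨ cong (λ b → ind (p j) + (∑ (upTo N) (ind ∘ q) + ind b)) qN≡false ⟩
  ind (p j) + (∑ (upTo N) (ind ∘ q) + 0)          ≡⟨ cong (ind (p j) +_) (+-identityʳ _) ⟩
  ind (p j) + ∑ (upTo N) (ind ∘ q)                ≡⟨ cong (ind (p j) +_) (sym (length-filterᵇ q (upTo N))) ⟩
  ind (p j) + length (occurrences τ w)            ∎
  where
  open ≡-Reasoning
  τ = t ∷ ts
  σ = w ∷ʳ c
  m = length τ
  N = length w
  p = occAtᵇ τ σ
  q = occAtᵇ τ w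
  j = length σ ∸ m

  |σ|≡1+N : length σ ≡ suc N
  |σ|≡1+N = trans (length-++ w) (+-comm N 1)

  j<|σ| : j < length σ
  j<|σ| = ≤-trans (s≤s (≤-trans (≤-reflexive (cong (_∸ m) |σ|≡1+N)) (m∸n≤m N (length ts))))
                  (≤-reflexive (sym |σ|≡1+N))

  qj≡false : q j ≡ false
  qj≡false = occAt-beyond τ w j (≤-trans (≤-reflexive (sym |σ|≡1+N))
                                         (subst (length σ ≤_) (+-comm m j) (m≤n+m∸n (length σ) m)))

  qN≡false : q N ≡ false
  qN≡false = occAt-beyond τ w N (m<m+n N z<s)

  p≗q : ∀ i → i < length σ → ¬ i ≡ j → ind (p i) ≡ ind (q i)
  p≗q i _ i≢j with i + m ≤? N
  ... | yes i+m≤N = cong ind (occAt-++ τ w (c ∷ []) i i+m≤N)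
  ... | no  i+m≰N = cong ind (trans (occAt-beyond τ σ i |σ|<i+m) (sym (occAt-beyond τ w i N<i+m)))
    where
    N<i+m : N < i + m
    N<i+m = ≰⇒> i+m≰N
    |σ|<i+m : length σ < i + m
    |σ|<i+m = ≤∧≢⇒< (≤-trans (≤-reflexive |σ|≡1+N) N<i+m)
                     (λ |σ|≡i+m → i≢j (trans (sym (m+n∸n≡m i m)) (cong (_∸ m) (sym |σ|≡i+m))))

[P≡0]+[P≡1∧b]≡[Q≡0] : (P Q : ℕ) (b : Bool) → P ≡ ind b + Q →
                      ind (P ≡ᵇ 0) + ind ((P ≡ᵇ 1) ∧ b) ≡ ind (Q ≡ᵇ 0)
[P≡0]+[P≡1∧b]≡[Q≡0] P zero          true  refl = refl
[P≡0]+[P≡1∧b]≡[Q≡0] P (suc Q)       true  refl = refl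
[P≡0]+[P≡1∧b]≡[Q≡0] P zero          false refl = refl
[P≡0]+[P≡1∧b]≡[Q≡0] P (suc zero)    false refl = refl
[P≡0]+[P≡1∧b]≡[Q≡0] P (suc (suc Q)) false refl = refl

avoids+quasiAvoids-∷ʳ : (t : ℕ) (ts w : List ℕ) (c : ℕ) →
  ind (avoidsᵇ (t ∷ ts) (w ∷ʳ c)) + ind (quasiAvoidsᵇ (t ∷ ts) (w ∷ʳ c)) ≡ ind (avoidsᵇ (t ∷ ts) w)
avoids+quasiAvoids-∷ʳ t ts w c = [P≡0]+[P≡1∧b]≡[Q≡0] _ _ _ (length-occurrences-∷ʳ t ts w c)

a+a*-suc : (t : ℕ) (ts : List ℕ) (k n : ℕ) → a (t ∷ ts) k (suc n) + a* (t ∷ ts) k (suc n) ≡ k * a (t ∷ ts) k n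
a+a*-suc t ts k n =
  count-words-∷ʳ k n (avoidsᵇ (t ∷ ts)) (quasiAvoidsᵇ (t ∷ ts)) (avoidsᵇ (t ∷ ts)) (avoids+quasiAvoids-∷ʳ t ts)

m+n≡o⇒+n≡+o-+m : {m n o : ℕ} → m + n ≡ o → ℤ.+ n ≡ ℤ.+ o ℤ.- ℤ.+ m
m+n≡o⇒+n≡+o-+m {m} {n} {o} m+n≡o = begin
  ℤ.+ n               ≡⟨ cong ℤ.+_ (sym (m+n∸m≡n m n)) ⟩
  ℤ.+ (m + n ∸ m)     ≡⟨ sym (ℤₚ.≤-⊖ (m≤m+n m n)) ⟩
  (m + n) ℤ.⊖ m       ≡⟨ cong (ℤ._⊖ m) m+n≡o ⟩
  o ℤ.⊖ m             ≡⟨ sym (ℤₚ.[+m]-[+n]≡m⊖n o m) ⟩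
  ℤ.+ o ℤ.- ℤ.+ m     ∎
  where open ≡-Reasoning

mainTheorem1 : (k ℓ : ℕ) → 1 ≤ k → (τ : List ℕ) → ¬ (τ ≡ []) →
    (∀ x → x ∈ℕ τ → 1 ≤ x × x ≤ ℓ) → (∀ j → 1 ≤ j → j ≤ ℓ → j ∈ℕ τ) →
    ∀ n → A* τ k n ≡ ((((ℤ.+ k) ⊛ X· (A τ k)) ⊖ A τ k) ⊕ one) n
mainTheorem1 _ _ _ []       τ≢[] _ _ _    = ⊥-elim (τ≢[] refl)
mainTheorem1 k _ _ (t ∷ ts) _    _ _ zero = cong (λ u → u ℤ.- ℤ.1ℤ ℤ.+ ℤ.1ℤ) (sym (ℤₚ.*-zeroʳ (ℤ.+ k)))
mainTheorem1 k _ _ (t ∷ ts) _    _ _ (suc n) = begin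
  A* τ k (suc n)                                      ≡⟨ m+n≡o⇒+n≡+o-+m (a+a*-suc t ts k n) ⟩
  ℤ.+ (k * a τ k n) ℤ.- A τ k (suc n)                 ≡⟨ cong (ℤ._- A τ k (suc n)) (ℤₚ.pos-* k (a τ k n)) ⟩
  ℤ.+ k ℤ.* A τ k n ℤ.- A τ k (suc n)                 ≡⟨ sym (ℤₚ.+-identityʳ _) ⟩
  ((((ℤ.+ k) ⊛ X· (A τ k)) ⊖ A τ k) ⊕ one) (suc n)    ∎
  where
  open ≡-Reasoning
  τ = t ∷ ts
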